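{- Let $\mathbf{k}$ be a commutative ring, $\beta,\alpha\in\mathbf{k}$, $n$ a positive integer, $\mathcal{X}=\mathbf{k}[x_{i,j}\mid 1\le i<j\le n]$, and let $\mathfrak{m}$ be a pathless monomial in the $x_{i,j}$. Then: (a) there exists a subset $S\subseteq\{1,\dots,n-1\}$ such that $\mathfrak{m}$ is $S$-friendly; (b) for any such $S$, we have $\mathfrak{m}\in\mathcal{X}_S$ and $E(D(\mathfrak{m}))=B_S(A_S(\mathfrak{m}))$ (as elements of $\mathcal{T}[[w]]$).
   Context: A monomial is pathless if no $x_{i,j}x_{j,k}$ with $i<j<k$ divides it. For $S\subseteq\{1,\dots,n-1\}$ let $\mathfrak{P}_S$ be the set of pairs $(i,j)$ with $i\in S$, $j\in\{1,\dots,n\}\setminus S$, $i<j$; a monomial is $S$-friendly if it is a product of indeterminates $x_{i,j}$ with $(i,j)\in\mathfrak{P}_S$; $\mathcal{X}_S=\mathbf{k}[x_{i,j}\mid(i,j)\in\mathfrak{P}_S]\subseteq\mathcal{X}$. $D\colon\mathcal{X}\to\mathcal{T}'=\mathbf{k}[t_1,\dots,t_{n-1}]$ is the $\mathbf{k}$-algebra homomorphism with $D(x_{i,j})=t_i$; $E\colon\mathcal{T}'\to\mathcal{T}'[[w]]$ is the $\mathbf{k}$-algebra homomorphism with $E(t_i)=-\frac{t_i+\beta+\alpha w}{1-t_iw}$. $\mathcal{Q}$ is the $\mathbf{k}$-algebra of Laurent series in $r_1,\dots,r_n$ (formal infinite $\mathbf{k}$-combinations of Laurent monomials with all exponents bounded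 below by a common integer, product topology); $q_i=r_i\cdots r_n$. A tuple $a\in\mathbb{Z}^n$ is $S$-adequate if $a_i\ge0$ for $i\in S$ and $a_i\le0$ for $i\notin S$; $\mathcal{Q}_S\subseteq\mathcal{Q}$ consists of the elements that are infinite combinations of $q_1^{a_1}\cdots q_n^{a_n}$ with $S$-adequate $a$. $A_S\colon\mathcal{X}_S\to\mathcal{Q}_S$ is the $\mathbf{k}$-algebra homomorphism with $A_S(x_{i,j})=-\frac{q_i+\beta+\alpha/q_j}{1-q_i/q_j}$ for $(i,j)\in\mathfrak{P}_S$ (with $1/(1-q_i/q_j)=\sum_{m\ge0}(q_i/q_j)^m$). $\mathcal{T}=\mathbf{k}[[t_1,\dots,t_n]]$, $\mathcal{T}_S=\mathbf{k}[[t_i\mid i\in S]]$; $B_S\colon\mathcal{Q}_S\to\mathcal{T}_S[[w]]$ is the continuous $\mathbf{k}$-linear map with $B_S(q_1^{a_1}\cdots q_n^{a_n})=\big(\prod_{i\in S}t_i^{a_i}\big)\big(\prod_{i\notin S}w^{ -a_i}\big)$ for $S$-adequate $a$. $\mathcal{T}'[[w]]$ and $\mathcal{T}_S[[w]]$ are regarded as subrings of $\mathcal{T}[[w]]$. -}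

module Defs where

open import Level using (Level)
open import Algebra.Bundles using (CommutativeRing)
open import Data.Nat as ℕ using (ℕ; zero; suc; _∸_; _≡ᵇ_)
open import Data.Integer as ℤ using (ℤ)
open import Data.Fin as Fin using (Fin; toℕ)
open import Data.Fin.Subset using (Subset; _∈_; _∉_)
open import Data.Vec as Vec using (Vec; []; _∷_; lookup; tabulate; zipWith)
open import Data.List as List using (List; []; _∷_)
open import Data.List.Relation.Unary.All using (All)
import Data.List.Membership.Propositional as LMem
open import Data.Product using (_×_; _,_; proj₁; proj₂)
open import Data.Bool using (Bool; true; false; if_then_else_; _∧_)
open import Relation.Nullary using (¬_)

box : ∀ {m} → Vec ℕ m → List (Vec ℕ m)
box [] = [] ∷ []
box (b ∷ bs) = List.concatMap (λ x → List.map (x ∷_) (box bs)) (List.upTo (suc b))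

_==v_ : ∀ {m} → Vec ℕ m → Vec ℕ m → Bool
[] ==v [] = true
(x ∷ xs) ==v (y ∷ ys) = (x ≡ᵇ y) ∧ (xs ==v ys)

zeroV : ∀ {m} → Vec ℕ m
zeroV = Vec.replicate _ 0

unitV : ∀ {m} → Fin m → Vec ℕ m
unitV i = tabulate (λ k → if toℕ k ≡ᵇ toℕ i then 1 else 0)

total : ∀ {m} → Vec ℕ m → ℕ
total = Vec.foldr _ ℕ._+_ 0

-- Monomials in the x_{i,j} (indices 1..n are Fin n = 0..n-1).
-- A monomial is a list of factors (i , j), i.e. the product of the x_{i,j}.

Mon : ℕ → Set
Mon n = List (Fin n × Fin n)

WellFormed : ∀ {n} → Mon n → Set
WellFormed m = All (λ p → proj₁ p Fin.< proj₂ p) m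

-- x_{i,j} x_{j,k} divides m (for i<j<k) iff both factors occur in m
Pathless : ∀ {n} → Mon n → Set
Pathless {n} m = ∀ (i j k : Fin n) → i Fin.< j → j Fin.< k →
  ¬ ((i , j) LMem.∈ m × (j , k) LMem.∈ m)

-- S ⊆ {1,…,n-1}
InRange : ∀ {n} → Subset n → Set
InRange {n} S = ∀ i → i ∈ S → suc (toℕ i) ℕ.< n

-- m is a product of x_{i,j} with (i,j) ∈ 𝔓_S (i<j is WellFormed)
Friendly : ∀ {n} → Subset n → Mon n → Set
Friendly S m = All (λ p → proj₁ p ∈ S × proj₂ p ∉ S) m

module Series {c ℓ} (R : CommutativeRing c ℓ) where
  open CommutativeRing R

  Ser : ℕ → Set c
  Ser m = Vec ℕ m → Carrier

  _≋_ : ∀ {m} → Ser m → Ser m → Set ℓ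
  f ≋ g = ∀ e → f e ≈ g e

  Σl : List Carrier → Carrier
  Σl = List.foldr _+_ 0#

  const : ∀ {m} → Carrier → Ser m
  const a e = if e ==v zeroV then a else 0#

  var : ∀ {m} → Fin m → Ser m
  var i e = if e ==v unitV i then 1# else 0#

  infixl 6 _⊕_
  infixl 7 _⊛_
  _⊕_ : ∀ {m} → Ser m → Ser m → Ser m
  (f ⊕ g) e = f e + g e

  _⊛_ : ∀ {m} → Ser m → Ser m → Ser m
  (f ⊛ g) e = Σl (List.map (λ e' → f e' * g (zipWith _∸_ e e')) (box e))

  neg : ∀ {m} → Ser m → Ser m
  neg f e = - f e

  scale : ∀ {m} → Carrier → Ser m → Ser m
  scale a f e = a * f e

  pow : ∀ {m} → Ser m → ℕ → Ser m
  pow f zero = const 1#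
  pow f (suc k) = f ⊛ pow f k

  -- 1/(1-f) = Σ_{k≥0} f^k, for f without constant term
  -- (f^k has no terms of total degree < k, so the sum is finite coefficientwise)
  geom : ∀ {m} → Ser m → Ser m
  geom f e = Σl (List.map (λ k → pow f k e) (List.upTo (suc (total e))))

  prod : ∀ {m} → List (Ser m) → Ser m
  prod = List.foldr _⊛_ (const 1#)

module Maps {c ℓ} (R : CommutativeRing c ℓ) (β α : CommutativeRing.Carrier R) (n : ℕ) where
  open CommutativeRing R using (Carrier; 0#)
  open Series R

  -- 𝒯[[w]] = k[[t_1,…,t_n]][[w]] : exponent vector (d ∷ e), d = exponent of w,
  -- e i = exponent of t_i.
  TW : Set c
  TW = Ser (suc n)

  tvar : Fin n → TW
  tvar i = var (Fin.suc i)

  wvar : TW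
  wvar = var Fin.zero

  -- a monomial of 𝒯' = k[t_1,…,t_{n-1}], as a list of factors t_i
  TMon : Set
  TMon = List (Fin n)

  D : Mon n → TMon
  D = List.map proj₁

  -- E(t_i) = -(t_i + β + α w)/(1 - t_i w)
  Et : Fin n → TW
  Et i = neg ((tvar i ⊕ const β ⊕ scale α wvar) ⊛ geom (tvar i ⊛ wvar))

  E : TMon → TW
  E tm = prod (List.map Et tm)

  -- 𝒬_S : Laurent series Σ_a c_a q_1^{a_1}⋯q_n^{a_n} over S-adequate a.
  -- Represented by the coefficient function, the coefficient of q^a stored at
  -- the vector (|a_1|,…,|a_n|) (a is recovered from |a| and S since a is S-adequate).
  QS : Subset n → Set c
  QS S = Ser n

  absV : Vec ℤ n → Vec ℕ n
  absV = Vec.map ℤ.∣_∣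

  qmon : (S : Subset n) → Vec ℤ n → QS S
  qmon S a b = if b ==v absV a then CommutativeRing.1# R else 0#

  eZ : Fin n → Vec ℤ n
  eZ i = tabulate (λ k → if toℕ k ≡ᵇ toℕ i then ℤ.+ 1 else ℤ.+ 0)

  -- A_S(x_{i,j}) = -(q_i + β + α/q_j)/(1 - q_i/q_j),  (i,j) ∈ 𝔓_S
  Ax : (S : Subset n) → Fin n → Fin n → QS S
  Ax S i j = neg ((qmon S (eZ i) ⊕ const β ⊕ scale α (qmon S (Vec.map ℤ.-_ (eZ j))))
                  ⊛ geom (qmon S (zipWith ℤ._-_ (eZ i) (eZ j))))

  A : (S : Subset n) → (m : Mon n) → Friendly S m → QS S
  A S m _ = prod (List.map (λ p → Ax S (proj₁ p) (proj₂ p)) m)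

  inS : Subset n → Fin n → Bool
  inS S i = lookup S i

  -- B_S(q^a) = (∏_{i∈S} t_i^{a_i}) (∏_{i∉S} w^{-a_i}), extended linearly and continuously:
  -- coefficient of w^d t^e in B_S(f) is the sum of the coefficients of q^a over
  -- S-adequate a with a_i = e_i (i ∈ S), Σ_{i∉S} (-a_i) = d, provided e_i = 0 for i ∉ S.
  B : (S : Subset n) → QS S → TW
  B S f (d ∷ e) =
    if Vec.foldr _ _∧_ true (tabulate (λ i → if inS S i then true else (lookup e i ≡ᵇ 0)))
    then Σl (List.map (λ b → if ok b then f b else 0#) (box bound))
    else 0#
    where
    bound : Vec ℕ n
    bound = tabulate (λ i → if inS S i then lookup e i else d)
    ok : Vec ℕ n → Bool
    ok b = Vec.foldr _ _∧_ true (tabulate (λ i → if inS S i then (lookup b i ≡ᵇ lookup e i) else true))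
           ∧ (Vec.foldr _ ℕ._+_ 0 (tabulate (λ i → if inS S i then 0 else lookup b i)) ≡ᵇ d)

-- (a) Take S to be the set of first indices i of the factors x_{i,j} of 𝔪: every factor
-- then has i ∈ S, and pathlessness says precisely that no second index j lies in S.
--
-- (b) A coefficient of 𝒬_S is stored at |a|, so B_S is the pushforward of coefficients
-- along |a| ↦ (Σ_{i∉S} |a_i| ; (|a_i|)_{i∈S}). This map is additive, preserves total
-- degree and has bounded fibres, so pushing forward commutes with sums, scalars,
-- products and the geometric series. It therefore suffices to look at one factor, where
-- q_i ↦ t_i (i ∈ S) and 1/q_j ↦ w (j ∉ S) turn A_S(x_{i,j}) into E(t_i) = E(D(x_{i,j})).

module Submission where

open import Defs
open import Algebra.Bundles using (CommutativeRing)
open import Data.Nat using (ℕ; _≤_)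
open import Data.Fin.Subset using (Subset)
open import Data.Product using (Σ; _×_)

open import Algebra.Bundles using (CommutativeMonoid)
open import Data.Bool using (Bool; true; false; if_then_else_; _∧_)
open import Data.Bool.Properties using (∧-comm; ∧-assoc; ∧-identityʳ; ∧-commutativeMonoid; T-≡; if-float)
open import Algebra.Properties.CommutativeSemigroup
  (CommutativeMonoid.commutativeSemigroup ∧-commutativeMonoid) using () renaming (interchange to ∧-interchange)
open import Data.Empty using (⊥-elim)
open import Data.Fin as Fin using (Fin; toℕ)
import Data.Fin.Properties as Fin
open import Data.Fin.Subset using (_∈_; _∉_)
import Data.Integer as ℤ
open import Data.List as List using (List; []; _∷_)
import Data.List.Membership.Propositional as LMem
open import Data.List.Properties using (map-applyUpTo)
open import Data.List.Relation.Unary.All as All using ([]; _∷_)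
open import Data.List.Relation.Unary.Any using (any?)
open import Data.Nat as ℕ using (zero; suc; _∸_; _≡ᵇ_; _≤ᵇ_; z≤n; s≤s)
import Data.Nat.Properties as ℕ
import Algebra.Properties.CommutativeMonoid.Sum ℕ.+-0-commutativeMonoid as ℕ-Sum
open import Data.Product using (_,_; proj₁; ∃-syntax)
open import Data.Vec as Vec using (Vec; []; _∷_; lookup; tabulate; zipWith)
open import Data.Vec.Properties
  using ( lookup∘tabulate; tabulate∘lookup; tabulate-cong; lookup-zipWith; lookup-map; lookup-replicate
        ; []=⇒lookup; lookup⇒[]=)
open import Function using (_∘_; Equivalence)
open import Level using (Level)
open import Relation.Binary.Bundles using (Setoid)
open import Relation.Binary.PropositionalEquality
  using (_≡_; _≢_; refl; sym; trans; cong; cong₂; subst; module ≡-Reasoning)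
open import Relation.Nullary using (does; yes; no)
open import Relation.Nullary.Decidable using (dec-true)

≡ᵇ⇒≡ : ∀ m n → (m ≡ᵇ n) ≡ true → m ≡ n
≡ᵇ⇒≡ m n = ℕ.≡ᵇ⇒≡ m n ∘ Equivalence.from T-≡

≡ᵇ-sym : ∀ m n → (m ≡ᵇ n) ≡ (n ≡ᵇ m)
≡ᵇ-sym zero    zero    = refl
≡ᵇ-sym zero    (suc n) = refl
≡ᵇ-sym (suc m) zero    = refl
≡ᵇ-sym (suc m) (suc n) = ≡ᵇ-sym m n

≤ᵇ⇒≤ : ∀ m n → (m ≤ᵇ n) ≡ true → m ≤ n
≤ᵇ⇒≤ m n = ℕ.≤ᵇ⇒≤ m n ∘ Equivalence.from T-≡

≤⇒≤ᵇ : ∀ {m n} → m ≤ n → (m ≤ᵇ n) ≡ true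
≤⇒≤ᵇ = Equivalence.to T-≡ ∘ ℕ.≤⇒≤ᵇ

-- Needed because _≤ᵇ_ is defined through _<ᵇ_, so this does not hold definitionally.
suc-≤ᵇ-suc : ∀ m n → (suc m ≤ᵇ suc n) ≡ (m ≤ᵇ n)
suc-≤ᵇ-suc zero    n = refl
suc-≤ᵇ-suc (suc m) n = refl

≤ᵇ∧≡ᵇ∸⇔+≡ᵇ : ∀ a b c → ((a ≤ᵇ c) ∧ (b ≡ᵇ (c ∸ a))) ≡ ((a ℕ.+ b) ≡ᵇ c)
≤ᵇ∧≡ᵇ∸⇔+≡ᵇ zero    b c       = refl
≤ᵇ∧≡ᵇ∸⇔+≡ᵇ (suc a) b zero    = refl
≤ᵇ∧≡ᵇ∸⇔+≡ᵇ (suc a) b (suc c) =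
  trans (cong (_∧ (b ≡ᵇ (c ∸ a))) (suc-≤ᵇ-suc a c)) (≤ᵇ∧≡ᵇ∸⇔+≡ᵇ a b c)

allᵇ : ∀ {m} → (Fin m → Bool) → Bool
allᵇ F = Vec.foldr _ _∧_ true (tabulate F)

allᵇ-∧ : ∀ {m} (F G : Fin m → Bool) → allᵇ (λ i → F i ∧ G i) ≡ (allᵇ F ∧ allᵇ G)
allᵇ-∧ {zero}  F G = refl
allᵇ-∧ {suc m} F G with F Fin.zero | G Fin.zero
... | true  | true  = allᵇ-∧ (F ∘ Fin.suc) (G ∘ Fin.suc)
... | true  | false = sym (∧-comm (allᵇ (F ∘ Fin.suc)) false)
... | false | _     = refl

allᵇ-cong : ∀ {m} {F G : Fin m → Bool} → (∀ i → F i ≡ G i) → allᵇ F ≡ allᵇ G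
allᵇ-cong F≡G = cong (Vec.foldr _ _∧_ true) (tabulate-cong F≡G)

separatedBy : ∀ {m} (S : Vec Bool m) {i j} → lookup S i ≡ true → lookup S j ≡ false → i ≢ j
separatedBy S si sj refl with trans (sym si) sj
... | ()

∉⇒lookup≡false : ∀ {m} (S : Subset m) {j} → j ∉ S → lookup S j ≡ false
∉⇒lookup≡false S {j} j∉S with lookup S j in sj
... | true  = ⊥-elim (j∉S (lookup⇒[]= j S sj))
... | false = refl

infixl 6 _+v_ _∸v_
infix 4 _≤v_

_+v_ : ∀ {m} → Vec ℕ m → Vec ℕ m → Vec ℕ m
_+v_ = zipWith ℕ._+_

_∸v_ : ∀ {m} → Vec ℕ m → Vec ℕ m → Vec ℕ m
_∸v_ = zipWith _∸_

_≤v_ : ∀ {m} → Vec ℕ m → Vec ℕ m → Bool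
[]       ≤v []       = true
(x ∷ xs) ≤v (y ∷ ys) = (x ≤ᵇ y) ∧ (xs ≤v ys)

lookup-ext : ∀ {m} {A : Set} (u v : Vec A m) → (∀ i → lookup u i ≡ lookup v i) → u ≡ v
lookup-ext u v h = trans (sym (tabulate∘lookup u)) (trans (tabulate-cong h) (tabulate∘lookup v))

==v⇒≡ : ∀ {m} (u v : Vec ℕ m) → (u ==v v) ≡ true → u ≡ v
==v⇒≡ []      []      _ = refl
==v⇒≡ (x ∷ u) (y ∷ v) e with x ≡ᵇ y in x≡y
... | true = cong₂ _∷_ (≡ᵇ⇒≡ x y x≡y) (==v⇒≡ u v e)

==v-sym : ∀ {m} (u v : Vec ℕ m) → (u ==v v) ≡ (v ==v u)
==v-sym []      []      = refl
==v-sym (x ∷ u) (y ∷ v) = cong₂ _∧_ (≡ᵇ-sym x y) (==v-sym u v)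

tabulate-==v : ∀ {m} (G : Fin m → ℕ) (e : Vec ℕ m) →
  (tabulate G ==v e) ≡ allᵇ (λ i → G i ≡ᵇ lookup e i)
tabulate-==v G []      = refl
tabulate-==v G (x ∷ e) = cong ((G Fin.zero ≡ᵇ x) ∧_) (tabulate-==v (G ∘ Fin.suc) e)

≤v⇒≤ : ∀ {m} (u v : Vec ℕ m) → (u ≤v v) ≡ true → ∀ i → lookup u i ≤ lookup v i
≤v⇒≤ (x ∷ u) (y ∷ v) e i with x ≤ᵇ y in x≤y
≤v⇒≤ (x ∷ u) (y ∷ v) e Fin.zero    | true = ≤ᵇ⇒≤ x y x≤y
≤v⇒≤ (x ∷ u) (y ∷ v) e (Fin.suc i) | true = ≤v⇒≤ u v e i

≤⇒≤v : ∀ {m} (u v : Vec ℕ m) → (∀ i → lookup u i ≤ lookup v i) → (u ≤v v) ≡ true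
≤⇒≤v []      []      h = refl
≤⇒≤v (x ∷ u) (y ∷ v) h rewrite ≤⇒≤ᵇ (h Fin.zero) = ≤⇒≤v u v (h ∘ Fin.suc)

∸v-≤v : ∀ {m} (y y' : Vec ℕ m) → (y ∸v y' ≤v y) ≡ true
∸v-≤v y y' = ≤⇒≤v (y ∸v y') y λ i →
  ℕ.≤-trans (ℕ.≤-reflexive (lookup-zipWith _∸_ i y y')) (ℕ.m∸n≤m (lookup y i) (lookup y' i))

+v-∸v : ∀ {m} (a b : Vec ℕ m) → (a ≤v b) ≡ true → a +v (b ∸v a) ≡ b
+v-∸v []      []      e = refl
+v-∸v (x ∷ a) (y ∷ b) e with x ≤ᵇ y in x≤y
... | true = cong₂ _∷_ (ℕ.m+[n∸m]≡n (≤ᵇ⇒≤ x y x≤y)) (+v-∸v a b e)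

≤v∧==v∸v⇔+v==v : ∀ {m} (u v y : Vec ℕ m) → ((u ≤v y) ∧ (v ==v (y ∸v u))) ≡ ((u +v v) ==v y)
≤v∧==v∸v⇔+v==v []      []      []      = refl
≤v∧==v∸v⇔+v==v (a ∷ u) (b ∷ v) (c ∷ y) =
  trans (∧-interchange (a ≤ᵇ c) (u ≤v y) (b ≡ᵇ (c ∸ a)) (v ==v (y ∸v u)))
        (cong₂ _∧_ (≤ᵇ∧≡ᵇ∸⇔+≡ᵇ a b c) (≤v∧==v∸v⇔+v==v u v y))

total-tabulate : ∀ {m} (f : Fin m → ℕ) → total (tabulate f) ≡ ℕ-Sum.sum f
total-tabulate {zero}  f = refl
total-tabulate {suc m} f = cong (f Fin.zero ℕ.+_) (total-tabulate (f ∘ Fin.suc))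

total-tabulate-+ : ∀ {m} (f g : Fin m → ℕ) →
  total (tabulate (λ i → f i ℕ.+ g i)) ≡ total (tabulate f) ℕ.+ total (tabulate g)
total-tabulate-+ f g rewrite total-tabulate (λ i → f i ℕ.+ g i) | total-tabulate f | total-tabulate g =
  ℕ-Sum.∑-distrib-+ f g

total-tabulate-0 : ∀ m → total (tabulate {n = m} (λ _ → 0)) ≡ 0
total-tabulate-0 zero    = refl
total-tabulate-0 (suc m) = total-tabulate-0 m

total-unitV : ∀ {m} (j : Fin m) → total (unitV j) ≡ 1
total-unitV {suc m} Fin.zero    = cong suc (total-tabulate-0 m)
total-unitV {suc m} (Fin.suc j) = total-unitV j

lookup≤total : ∀ {m} (v : Vec ℕ m) i → lookup v i ≤ total v
lookup≤total (x ∷ v) Fin.zero    = ℕ.m≤m+n x (total v)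
lookup≤total (x ∷ v) (Fin.suc i) = ℕ.≤-trans (lookup≤total v i) (ℕ.m≤n+m (total v) x)

tabulate-+v : ∀ {m} (f g : Fin m → ℕ) → tabulate (λ i → f i ℕ.+ g i) ≡ tabulate f +v tabulate g
tabulate-+v {zero}  f g = refl
tabulate-+v {suc m} f g = cong (f Fin.zero ℕ.+ g Fin.zero ∷_) (tabulate-+v (f ∘ Fin.suc) (g ∘ Fin.suc))

lookup-unitV : ∀ {m} (i k : Fin m) → lookup (unitV i) k ≡ (if toℕ k ≡ᵇ toℕ i then 1 else 0)
lookup-unitV i k = lookup∘tabulate (λ k → if toℕ k ≡ᵇ toℕ i then 1 else 0) k

toℕ-≡ᵇ⇒≡ : ∀ {m} (k i : Fin m) → (toℕ k ≡ᵇ toℕ i) ≡ true → k ≡ i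
toℕ-≡ᵇ⇒≡ k i = Fin.toℕ-injective ∘ ≡ᵇ⇒≡ (toℕ k) (toℕ i)

lookup-unitV-≢ : ∀ {m} {i k : Fin m} → k ≢ i → lookup (unitV i) k ≡ 0
lookup-unitV-≢ {i = i} {k} k≢i rewrite lookup-unitV i k with toℕ k ≡ᵇ toℕ i in k≡i
... | true  = ⊥-elim (k≢i (toℕ-≡ᵇ⇒≡ k i k≡i))
... | false = refl

module FiniteSums {c ℓ} (R : CommutativeRing c ℓ) where
  open CommutativeRing R renaming (refl to ≈-refl; sym to ≈-sym; trans to ≈-trans)
  open Series R using (Σl)
  open import Algebra.Properties.CommutativeSemigroup +-commutativeSemigroup using (x∙yz≈y∙xz)
  open import Relation.Binary.Reasoning.Setoid setoid

  when : Bool → Carrier → Carrier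
  when b x = if b then x else 0#

  when-cong : ∀ b {x y} → x ≈ y → when b x ≈ when b y
  when-cong true  x≈y = x≈y
  when-cong false _   = ≈-refl

  when-≡ : ∀ {a b} x → a ≡ b → when a x ≈ when b x
  when-≡ x refl = ≈-refl

  when-0 : ∀ b → when b 0# ≈ 0#
  when-0 true  = ≈-refl
  when-0 false = ≈-refl

  when-∧ : ∀ a b x → when (a ∧ b) x ≡ when a (when b x)
  when-∧ true  b x = refl
  when-∧ false b x = refl

  when-swap : ∀ a b x → when a (when b x) ≡ when b (when a x)
  when-swap true  b     x = refl
  when-swap false true  x = refl
  when-swap false false x = refl

  when-*ˡ : ∀ a x y → when a x * y ≈ when a (x * y)
  when-*ˡ true  x y = ≈-refl
  when-*ˡ false x y = zeroˡ y

  when-*ʳ : ∀ a x y → x * when a y ≈ when a (x * y)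
  when-*ʳ true  x y = ≈-refl
  when-*ʳ false x y = zeroʳ x

  when-+ : ∀ a x y → when a (x + y) ≈ when a x + when a y
  when-+ true  x y = ≈-refl
  when-+ false x y = ≈-sym (+-identityˡ 0#)

  private variable
    ℓ₁ ℓ₂ : Level
    A : Set ℓ₁
    B : Set ℓ₂

  sumMap : (A → Carrier) → List A → Carrier
  sumMap F xs = Σl (List.map F xs)

  sumMap-cong : ∀ {F G : A → Carrier} xs → (∀ x → F x ≈ G x) → sumMap F xs ≈ sumMap G xs
  sumMap-cong []       F≈G = ≈-refl
  sumMap-cong (x ∷ xs) F≈G = +-cong (F≈G x) (sumMap-cong xs F≈G)

  sumMap-zero : ∀ (F : A → Carrier) xs → (∀ x → F x ≈ 0#) → sumMap F xs ≈ 0#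
  sumMap-zero F []       F≈0 = ≈-refl
  sumMap-zero F (x ∷ xs) F≈0 = ≈-trans (+-cong (F≈0 x) (sumMap-zero F xs F≈0)) (+-identityˡ 0#)

  sumMap-+ : ∀ (F G : A → Carrier) xs → sumMap (λ x → F x + G x) xs ≈ sumMap F xs + sumMap G xs
  sumMap-+ F G []       = ≈-sym (+-identityˡ 0#)
  sumMap-+ F G (x ∷ xs) = begin
    (F x + G x) + sumMap (λ x → F x + G x) xs ≈⟨ +-congˡ (sumMap-+ F G xs) ⟩
    (F x + G x) + (sumMap F xs + sumMap G xs) ≈⟨ +-assoc (F x) (G x) _ ⟩
    F x + (G x + (sumMap F xs + sumMap G xs)) ≈⟨ +-congˡ (x∙yz≈y∙xz (G x) (sumMap F xs) (sumMap G xs)) ⟩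
    F x + (sumMap F xs + (G x + sumMap G xs)) ≈⟨ +-assoc (F x) _ _ ⟨
    (F x + sumMap F xs) + (G x + sumMap G xs) ∎

  sumMap-*ˡ : ∀ k (F : A → Carrier) xs → sumMap (λ x → k * F x) xs ≈ k * sumMap F xs
  sumMap-*ˡ k F []       = ≈-sym (zeroʳ k)
  sumMap-*ˡ k F (x ∷ xs) = ≈-trans (+-congˡ (sumMap-*ˡ k F xs)) (≈-sym (distribˡ k _ _))

  sumMap-*ʳ : ∀ k (F : A → Carrier) xs → sumMap (λ x → F x * k) xs ≈ sumMap F xs * k
  sumMap-*ʳ k F xs = ≈-trans (sumMap-cong xs (λ x → *-comm (F x) k)) (≈-trans (sumMap-*ˡ k F xs) (*-comm k _))

  sumMap-when : ∀ b (F : A → Carrier) xs → sumMap (λ x → when b (F x)) xs ≈ when b (sumMap F xs)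
  sumMap-when true  F xs = ≈-refl
  sumMap-when false F xs = sumMap-zero _ xs (λ _ → ≈-refl)

  sumMap-swap : ∀ (F : A → B → Carrier) xs (ys : List B) →
    sumMap (λ x → sumMap (F x) ys) xs ≈ sumMap (λ y → sumMap (λ x → F x y) xs) ys
  sumMap-swap F []       ys = ≈-sym (sumMap-zero _ ys (λ _ → ≈-refl))
  sumMap-swap F (x ∷ xs) ys =
    ≈-trans (+-congˡ (sumMap-swap F xs ys)) (≈-sym (sumMap-+ (F x) (λ y → sumMap (λ x → F x y) xs) ys))

  sumMap-++ : ∀ (F : A → Carrier) xs ys → sumMap F (xs List.++ ys) ≈ sumMap F xs + sumMap F ys
  sumMap-++ F []       ys = ≈-sym (+-identityˡ _)
  sumMap-++ F (x ∷ xs) ys = ≈-trans (+-congˡ (sumMap-++ F xs ys)) (≈-sym (+-assoc _ _ _))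

  sumMap-map : ∀ (F : B → Carrier) (h : A → B) xs → sumMap F (List.map h xs) ≈ sumMap (F ∘ h) xs
  sumMap-map F h []       = ≈-refl
  sumMap-map F h (x ∷ xs) = +-congˡ (sumMap-map F h xs)

  sumMap-concatMap : ∀ (F : B → Carrier) (h : A → List B) xs →
    sumMap F (List.concatMap h xs) ≈ sumMap (λ x → sumMap F (h x)) xs
  sumMap-concatMap F h []       = ≈-refl
  sumMap-concatMap F h (x ∷ xs) = ≈-trans (sumMap-++ F (h x) _) (+-congˡ (sumMap-concatMap F h xs))

  -- The sum of g k over 0 ≤ k ≤ K, bound included.
  sumUpTo : ℕ → (ℕ → Carrier) → Carrier
  sumUpTo K g = sumMap g (List.upTo (suc K))

  sumUpTo-unfold : ∀ K g → sumUpTo K g ≡ g 0 + sumMap (g ∘ suc) (List.upTo K)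
  sumUpTo-unfold K g =
    cong (g 0 +_) (cong Σl (trans (map-applyUpTo suc g K) (sym (map-applyUpTo (λ k → k) (g ∘ suc) K))))

  sumUpTo-cong : ∀ K {g h : ℕ → Carrier} → (∀ k → g k ≈ h k) → sumUpTo K g ≈ sumUpTo K h
  sumUpTo-cong K = sumMap-cong (List.upTo (suc K))

  sumUpTo-cong-≤ : ∀ K {g h : ℕ → Carrier} → (∀ k → k ≤ K → g k ≈ h k) → sumUpTo K g ≈ sumUpTo K h
  sumUpTo-cong-≤ zero    g≈h = +-congʳ (g≈h 0 z≤n)
  sumUpTo-cong-≤ (suc K) {g} {h} g≈h = begin
    sumUpTo (suc K) g
      ≡⟨ sumUpTo-unfold (suc K) g ⟩
    g 0 + sumUpTo K (g ∘ suc)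
      ≈⟨ +-cong (g≈h 0 z≤n) (sumUpTo-cong-≤ K (λ k k≤K → g≈h (suc k) (s≤s k≤K))) ⟩
    h 0 + sumUpTo K (h ∘ suc)
      ≡⟨ sumUpTo-unfold (suc K) h ⟨
    sumUpTo (suc K) h ∎

  sumUpTo-restrict : ∀ {M M'} → M ≤ M' → (g : ℕ → Carrier) →
    sumUpTo M' (λ k → when (k ≤ᵇ M) (g k)) ≈ sumUpTo M g
  sumUpTo-restrict {M' = M'} z≤n g = begin
    sumUpTo M' (λ k → when (k ≤ᵇ 0) (g k))
      ≡⟨ sumUpTo-unfold M' _ ⟩
    g 0 + sumMap (λ k → when (suc k ≤ᵇ 0) (g (suc k))) (List.upTo M')
      ≈⟨ +-congˡ (sumMap-zero _ (List.upTo M') (λ _ → ≈-refl)) ⟩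
    g 0 + 0# ∎
  sumUpTo-restrict {suc M} {suc M'} (s≤s M≤M') g = begin
    sumUpTo (suc M') (λ k → when (k ≤ᵇ suc M) (g k))
      ≡⟨ sumUpTo-unfold (suc M') _ ⟩
    g 0 + sumUpTo M' (λ k → when (suc k ≤ᵇ suc M) (g (suc k)))
      ≈⟨ +-congˡ (sumUpTo-cong M' (λ k → when-≡ _ (suc-≤ᵇ-suc k M))) ⟩
    g 0 + sumUpTo M' (λ k → when (k ≤ᵇ M) (g (suc k)))
      ≈⟨ +-congˡ (sumUpTo-restrict M≤M' (g ∘ suc)) ⟩
    g 0 + sumUpTo M (g ∘ suc)
      ≡⟨ sumUpTo-unfold (suc M) g ⟨
    sumUpTo (suc M) g ∎

  sumUpTo-shift : ∀ a M (G : ℕ → Carrier) →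
    sumUpTo M (λ k → when (a ≤ᵇ k) (G (k ∸ a))) ≈ sumUpTo M (λ k → when ((a ℕ.+ k) ≤ᵇ M) (G k))
  sumUpTo-shift zero    M       G = ≈-sym (sumUpTo-restrict {M} ℕ.≤-refl G)
  sumUpTo-shift (suc a) zero    G = ≈-refl
  sumUpTo-shift (suc a) (suc M) G = begin
    sumUpTo (suc M) (λ k → when (suc a ≤ᵇ k) (G (k ∸ suc a)))
      ≡⟨ sumUpTo-unfold (suc M) _ ⟩
    0# + sumUpTo M (λ k → when (suc a ≤ᵇ suc k) (G (k ∸ a)))
      ≈⟨ +-identityˡ _ ⟩
    sumUpTo M (λ k → when (suc a ≤ᵇ suc k) (G (k ∸ a)))
      ≈⟨ sumUpTo-cong M (λ k → when-≡ _ (suc-≤ᵇ-suc a k)) ⟩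
    sumUpTo M (λ k → when (a ≤ᵇ k) (G (k ∸ a)))
      ≈⟨ sumUpTo-shift a M G ⟩
    sumUpTo M H
      ≈⟨ sumUpTo-restrict (ℕ.n≤1+n M) H ⟨
    sumUpTo (suc M) (λ k → when (k ≤ᵇ M) (H k))
      ≈⟨ sumUpTo-cong (suc M) H-vanishes ⟩
    sumUpTo (suc M) H
      ≈⟨ sumUpTo-cong (suc M) (λ k → when-≡ _ (suc-≤ᵇ-suc (a ℕ.+ k) M)) ⟨
    sumUpTo (suc M) (λ k → when ((suc a ℕ.+ k) ≤ᵇ suc M) (G k)) ∎
    where
    H : ℕ → Carrier
    H k = when ((a ℕ.+ k) ≤ᵇ M) (G k)
    H-vanishes : ∀ k → when (k ≤ᵇ M) (H k) ≈ H k
    H-vanishes k with (a ℕ.+ k) ≤ᵇ M in a+k≤M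
    ... | false = when-0 (k ≤ᵇ M)
    ... | true  rewrite ≤⇒≤ᵇ (ℕ.m+n≤o⇒n≤o a (≤ᵇ⇒≤ (a ℕ.+ k) M a+k≤M)) = ≈-refl

  sumUpTo-delta : ∀ k₀ M (g : ℕ → Carrier) →
    sumUpTo M (λ k → when (k ≡ᵇ k₀) (g k)) ≈ when (k₀ ≤ᵇ M) (g k₀)
  sumUpTo-delta zero    M       g = begin
    sumUpTo M (λ k → when (k ≡ᵇ 0) (g k))
      ≡⟨ sumUpTo-unfold M _ ⟩
    g 0 + sumMap (λ k → when (suc k ≡ᵇ 0) (g (suc k))) (List.upTo M)
      ≈⟨ +-congˡ (sumMap-zero _ (List.upTo M) (λ _ → ≈-refl)) ⟩
    g 0 + 0#
      ≈⟨ +-identityʳ (g 0) ⟩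
    g 0 ∎
  sumUpTo-delta (suc k₀) zero    g = +-identityˡ 0#
  sumUpTo-delta (suc k₀) (suc M) g = begin
    sumUpTo (suc M) (λ k → when (k ≡ᵇ suc k₀) (g k))
      ≡⟨ sumUpTo-unfold (suc M) _ ⟩
    0# + sumUpTo M (λ k → when (k ≡ᵇ k₀) (g (suc k)))
      ≈⟨ +-identityˡ _ ⟩
    sumUpTo M (λ k → when (k ≡ᵇ k₀) (g (suc k)))
      ≈⟨ sumUpTo-delta k₀ M (g ∘ suc) ⟩
    when (k₀ ≤ᵇ M) (g (suc k₀))
      ≈⟨ when-≡ _ (suc-≤ᵇ-suc k₀ M) ⟨
    when (suc k₀ ≤ᵇ suc M) (g (suc k₀)) ∎

  boxSum : ∀ {m} → Vec ℕ m → (Vec ℕ m → Carrier) → Carrier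
  boxSum N F = sumMap F (box N)

  boxSum-cons : ∀ {m} x (N : Vec ℕ m) F → boxSum (x ∷ N) F ≈ sumUpTo x (λ k → boxSum N (F ∘ (k ∷_)))
  boxSum-cons x N F = ≈-trans (sumMap-concatMap F (λ k → List.map (k ∷_) (box N)) (List.upTo (suc x)))
                              (sumUpTo-cong x (λ k → sumMap-map F (k ∷_) (box N)))

  boxSum-cong : ∀ {m} (N : Vec ℕ m) {F G : Vec ℕ m → Carrier} →
    (∀ b → (b ≤v N) ≡ true → F b ≈ G b) → boxSum N F ≈ boxSum N G
  boxSum-cong []      F≈G = +-congʳ (F≈G [] refl)
  boxSum-cong (x ∷ N) {F} {G} F≈G = begin
    boxSum (x ∷ N) F
      ≈⟨ boxSum-cons x N F ⟩
    sumUpTo x (λ k → boxSum N (F ∘ (k ∷_)))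
      ≈⟨ sumUpTo-cong-≤ x (λ k k≤x →
           boxSum-cong N (λ e e≤N → F≈G (k ∷ e) (cong₂ _∧_ (≤⇒≤ᵇ k≤x) e≤N))) ⟩
    sumUpTo x (λ k → boxSum N (G ∘ (k ∷_)))
      ≈⟨ boxSum-cons x N G ⟨
    boxSum (x ∷ N) G ∎

  boxSum-when-∧ : ∀ {m} (N : Vec ℕ m) a (P : Vec ℕ m → Bool) (F : Vec ℕ m → Carrier) →
    boxSum N (λ e → when (a ∧ P e) (F e)) ≈ when a (boxSum N (λ e → when (P e) (F e)))
  boxSum-when-∧ N true  P F = ≈-refl
  boxSum-when-∧ N false P F = sumMap-zero _ (box N) (λ _ → ≈-refl)

  boxSum-restrict : ∀ {m} (N N' : Vec ℕ m) → (N ≤v N') ≡ true → (F : Vec ℕ m → Carrier) →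
    boxSum N' (λ b → when (b ≤v N) (F b)) ≈ boxSum N F
  boxSum-restrict []      []        _  F = ≈-refl
  boxSum-restrict (x ∷ N) (x' ∷ N') le F with x ≤ᵇ x' in x≤x'
  ... | true = begin
    boxSum (x' ∷ N') (λ b → when (b ≤v (x ∷ N)) (F b))
      ≈⟨ boxSum-cons x' N' _ ⟩
    sumUpTo x' (λ k → boxSum N' (λ b → when ((k ≤ᵇ x) ∧ (b ≤v N)) (F (k ∷ b))))
      ≈⟨ sumUpTo-cong x' (λ k → boxSum-when-∧ N' (k ≤ᵇ x) (_≤v N) (F ∘ (k ∷_))) ⟩
    sumUpTo x' (λ k → when (k ≤ᵇ x) (boxSum N' (λ b → when (b ≤v N) (F (k ∷ b)))))
      ≈⟨ sumUpTo-cong x' (λ k → when-cong (k ≤ᵇ x) (boxSum-restrict N N' le (F ∘ (k ∷_)))) ⟩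
    sumUpTo x' (λ k → when (k ≤ᵇ x) (boxSum N (F ∘ (k ∷_))))
      ≈⟨ sumUpTo-restrict (≤ᵇ⇒≤ x x' x≤x') _ ⟩
    sumUpTo x (λ k → boxSum N (F ∘ (k ∷_)))
      ≈⟨ boxSum-cons x N F ⟨
    boxSum (x ∷ N) F ∎

  boxSum-shift : ∀ {m} (N a : Vec ℕ m) (G : Vec ℕ m → Carrier) →
    boxSum N (λ b → when (a ≤v b) (G (b ∸v a))) ≈ boxSum N (λ c → when ((a +v c) ≤v N) (G c))
  boxSum-shift []      []       G = ≈-refl
  boxSum-shift (x ∷ N) (a₀ ∷ a) G = begin
    boxSum (x ∷ N) (λ b → when ((a₀ ∷ a) ≤v b) (G (b ∸v (a₀ ∷ a))))
      ≈⟨ boxSum-cons x N _ ⟩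
    sumUpTo x (λ k → boxSum N (λ e → when ((a₀ ≤ᵇ k) ∧ (a ≤v e)) (G ((k ∸ a₀) ∷ (e ∸v a)))))
      ≈⟨ sumUpTo-cong x (λ k → boxSum-when-∧ N (a₀ ≤ᵇ k) (a ≤v_) (λ e → G ((k ∸ a₀) ∷ (e ∸v a)))) ⟩
    sumUpTo x (λ k → when (a₀ ≤ᵇ k) (boxSum N (λ e → when (a ≤v e) (G ((k ∸ a₀) ∷ (e ∸v a))))))
      ≈⟨ sumUpTo-cong x (λ k → when-cong (a₀ ≤ᵇ k) (boxSum-shift N a (G ∘ ((k ∸ a₀) ∷_)))) ⟩
    sumUpTo x (λ k → when (a₀ ≤ᵇ k) (H (k ∸ a₀)))
      ≈⟨ sumUpTo-shift a₀ x H ⟩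
    sumUpTo x (λ k → when ((a₀ ℕ.+ k) ≤ᵇ x) (H k))
      ≈⟨ sumUpTo-cong x (λ k → boxSum-when-∧ N ((a₀ ℕ.+ k) ≤ᵇ x) (λ c → (a +v c) ≤v N) (G ∘ (k ∷_))) ⟨
    sumUpTo x (λ k → boxSum N (λ c → when (((a₀ ℕ.+ k) ≤ᵇ x) ∧ ((a +v c) ≤v N)) (G (k ∷ c))))
      ≈⟨ boxSum-cons x N _ ⟨
    boxSum (x ∷ N) (λ c → when (((a₀ ∷ a) +v c) ≤v (x ∷ N)) (G c)) ∎
    where
    H : ℕ → Carrier
    H j = boxSum N (λ c → when ((a +v c) ≤v N) (G (j ∷ c)))

  boxSum-delta : ∀ {m} (N b₀ : Vec ℕ m) (F : Vec ℕ m → Carrier) →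
    boxSum N (λ b → when (b ==v b₀) (F b)) ≈ when (b₀ ≤v N) (F b₀)
  boxSum-delta []      []         F = +-identityʳ _
  boxSum-delta (x ∷ N) (x₀ ∷ b₀) F = begin
    boxSum (x ∷ N) (λ b → when (b ==v (x₀ ∷ b₀)) (F b))
      ≈⟨ boxSum-cons x N _ ⟩
    sumUpTo x (λ k → boxSum N (λ e → when ((k ≡ᵇ x₀) ∧ (e ==v b₀)) (F (k ∷ e))))
      ≈⟨ sumUpTo-cong x (λ k → boxSum-when-∧ N (k ≡ᵇ x₀) (_==v b₀) (F ∘ (k ∷_))) ⟩
    sumUpTo x (λ k → when (k ≡ᵇ x₀) (boxSum N (λ e → when (e ==v b₀) (F (k ∷ e)))))
      ≈⟨ sumUpTo-cong x (λ k → when-cong (k ≡ᵇ x₀) (boxSum-delta N b₀ (F ∘ (k ∷_)))) ⟩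
    sumUpTo x (λ k → when (k ≡ᵇ x₀) (when (b₀ ≤v N) (F (k ∷ b₀))))
      ≈⟨ sumUpTo-delta x₀ x _ ⟩
    when (x₀ ≤ᵇ x) (when (b₀ ≤v N) (F (x₀ ∷ b₀)))
      ≡⟨ when-∧ (x₀ ≤ᵇ x) (b₀ ≤v N) _ ⟨
    when ((x₀ ∷ b₀) ≤v (x ∷ N)) (F (x₀ ∷ b₀)) ∎

module SeriesProperties {c ℓ} (R : CommutativeRing c ℓ) where
  open CommutativeRing R renaming (refl to ≈-refl; sym to ≈-sym; trans to ≈-trans)
  open Series R
  open FiniteSums R
  open import Relation.Binary.Reasoning.Setoid setoid

  ≋-setoid : ℕ → Setoid c ℓ
  ≋-setoid m = record
    { Carrier       = Ser m
    ; _≈_           = _≋_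
    ; isEquivalence = record
      { refl  = λ _ → ≈-refl
      ; sym   = λ f≋g e → ≈-sym (f≋g e)
      ; trans = λ f≋g g≋h e → ≈-trans (f≋g e) (g≋h e)
      }
    }

  module _ {m : ℕ} where
    open Setoid (≋-setoid m) public using () renaming (refl to ≋-refl; sym to ≋-sym; trans to ≋-trans)

  ⊕-cong : ∀ {m} {f f' g g' : Ser m} → f ≋ f' → g ≋ g' → (f ⊕ g) ≋ (f' ⊕ g')
  ⊕-cong f≋f' g≋g' e = +-cong (f≋f' e) (g≋g' e)

  ⊛-cong : ∀ {m} {f f' g g' : Ser m} → f ≋ f' → g ≋ g' → (f ⊛ g) ≋ (f' ⊛ g')
  ⊛-cong f≋f' g≋g' e = sumMap-cong (box e) (λ e' → *-cong (f≋f' e') (g≋g' _))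

  neg-cong : ∀ {m} {f g : Ser m} → f ≋ g → neg f ≋ neg g
  neg-cong f≋g e = -‿cong (f≋g e)

  scale-cong : ∀ {m} a {f g : Ser m} → f ≋ g → scale a f ≋ scale a g
  scale-cong a f≋g e = *-congˡ (f≋g e)

  pow-cong : ∀ {m} {f g : Ser m} → f ≋ g → ∀ k → pow f k ≋ pow g k
  pow-cong f≋g zero    = ≋-refl
  pow-cong f≋g (suc k) = ⊛-cong f≋g (pow-cong f≋g k)

  geom-cong : ∀ {m} {f g : Ser m} → f ≋ g → geom f ≋ geom g
  geom-cong f≋g e = sumUpTo-cong (total e) (λ k → pow-cong f≋g k e)

  -- const, var and the q-monomials of Defs are all monomials definitionally.
  monomial : ∀ {m} → Carrier → Vec ℕ m → Ser m
  monomial a u e = when (e ==v u) a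

  monomial-cong : ∀ {m} {a b} (u : Vec ℕ m) → a ≈ b → monomial a u ≋ monomial b u
  monomial-cong u a≈b e = when-cong (e ==v u) a≈b

  monomial-≡ : ∀ {m} a {u v : Vec ℕ m} → u ≡ v → monomial a u ≋ monomial a v
  monomial-≡ a refl = ≋-refl

  monomial-⊛ : ∀ {m} a b (u v : Vec ℕ m) → (monomial a u ⊛ monomial b v) ≋ monomial (a * b) (u +v v)
  monomial-⊛ a b u v e = begin
    boxSum e (λ e' → when (e' ==v u) a * when ((e ∸v e') ==v v) b)
      ≈⟨ sumMap-cong (box e) (λ e' → when-*ˡ (e' ==v u) a _) ⟩
    boxSum e (λ e' → when (e' ==v u) (a * when ((e ∸v e') ==v v) b))
      ≈⟨ boxSum-delta e u _ ⟩
    when (u ≤v e) (a * when ((e ∸v u) ==v v) b)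
      ≈⟨ when-cong (u ≤v e) (when-*ʳ ((e ∸v u) ==v v) a b) ⟩
    when (u ≤v e) (when ((e ∸v u) ==v v) (a * b))
      ≡⟨ when-∧ (u ≤v e) _ _ ⟨
    when ((u ≤v e) ∧ ((e ∸v u) ==v v)) (a * b)
      ≡⟨ cong (λ t → when ((u ≤v e) ∧ t) (a * b)) (==v-sym (e ∸v u) v) ⟩
    when ((u ≤v e) ∧ (v ==v (e ∸v u))) (a * b)
      ≡⟨ cong (λ t → when t (a * b)) (trans (≤v∧==v∸v⇔+v==v u v e) (==v-sym (u +v v) e)) ⟩
    when (e ==v (u +v v)) (a * b) ∎

module Pushforward {c ℓ} (R : CommutativeRing c ℓ) {n m : ℕ}
  (φ : Vec ℕ n → Vec ℕ m) (bound : Vec ℕ m → Vec ℕ n)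
  (φ-+v : ∀ b b' → φ (b +v b') ≡ φ b +v φ b')
  (φ-zero : φ zeroV ≡ zeroV)
  (total-φ : ∀ b → total (φ b) ≡ total b)
  (φ≡⇒≤bound : ∀ b y → (φ b ==v y) ≡ true → (b ≤v bound y) ≡ true)
  (bound-mono : ∀ y' y → (y' ≤v y) ≡ true → (bound y' ≤v bound y) ≡ true)
  where
  open CommutativeRing R renaming (refl to ≈-refl; sym to ≈-sym; trans to ≈-trans)
  open Series R
  open FiniteSums R
  open SeriesProperties R
  open import Algebra.Properties.Ring ring using (-1*x≈-x)
  open import Relation.Binary.Reasoning.Setoid setoid

  push : Ser n → Ser m
  push f y = boxSum (bound y) (λ b → when (φ b ==v y) (f b))

  when-≤bound : ∀ b y x → when (b ≤v bound y) (when (φ b ==v y) x) ≈ when (φ b ==v y) x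
  when-≤bound b y x with φ b ==v y in φb≡y
  ... | true  rewrite φ≡⇒≤bound b y φb≡y = ≈-refl
  ... | false = when-0 (b ≤v bound y)

  push-cong : ∀ {f g : Ser n} → f ≋ g → push f ≋ push g
  push-cong f≋g y = sumMap-cong (box (bound y)) (λ b → when-cong (φ b ==v y) (f≋g b))

  push-enlarge : ∀ f y N → (bound y ≤v N) ≡ true → push f y ≈ boxSum N (λ b → when (φ b ==v y) (f b))
  push-enlarge f y N le = ≈-sym (begin
    boxSum N (λ b → when (φ b ==v y) (f b))
      ≈⟨ boxSum-cong N (λ b _ → ≈-sym (when-≤bound b y (f b))) ⟩
    boxSum N (λ b → when (b ≤v bound y) (when (φ b ==v y) (f b)))
      ≈⟨ boxSum-restrict (bound y) N le _ ⟩
    push f y ∎)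

  push-monomial : ∀ a u → push (monomial a u) ≋ monomial a (φ u)
  push-monomial a u y = begin
    boxSum (bound y) (λ b → when (φ b ==v y) (when (b ==v u) a))
      ≈⟨ sumMap-cong (box (bound y)) (λ b → reflexive (when-swap (φ b ==v y) (b ==v u) a)) ⟩
    boxSum (bound y) (λ b → when (b ==v u) (when (φ b ==v y) a))
      ≈⟨ boxSum-delta (bound y) u _ ⟩
    when (u ≤v bound y) (when (φ u ==v y) a)
      ≈⟨ when-≤bound u y a ⟩
    when (φ u ==v y) a
      ≡⟨ cong (λ t → when t a) (==v-sym (φ u) y) ⟩
    when (y ==v φ u) a ∎

  push-const : ∀ a → push (const a) ≋ const a
  push-const a = ≋-trans (push-monomial a zeroV) (monomial-≡ a φ-zero)

  push-⊕ : ∀ f g → push (f ⊕ g) ≋ (push f ⊕ push g)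
  push-⊕ f g y =
    ≈-trans (sumMap-cong (box (bound y)) (λ b → when-+ (φ b ==v y) _ _)) (sumMap-+ _ _ (box (bound y)))

  push-scale : ∀ a f → push (scale a f) ≋ scale a (push f)
  push-scale a f y =
    ≈-trans (sumMap-cong (box (bound y)) (λ b → ≈-sym (when-*ʳ (φ b ==v y) a _))) (sumMap-*ˡ a _ (box (bound y)))

  push-neg : ∀ f → push (neg f) ≋ neg (push f)
  push-neg f y = begin
    push (neg f) y              ≈⟨ push-cong (λ e → ≈-sym (-1*x≈-x (f e))) y ⟩
    push (scale (- 1#) f) y     ≈⟨ push-scale (- 1#) f y ⟩
    - 1# * push f y             ≈⟨ -1*x≈-x (push f y) ⟩
    - push f y                  ∎

  -- Both sides of push (f ⊛ g) ≋ push f ⊛ push g are sums over pairs (b , c) with φ b +v φ c ≡ y.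
  pairSum : Ser n → Ser n → Ser m
  pairSum f g y = boxSum (bound y) (λ b → boxSum (bound y) (λ c → when ((φ b +v φ c) ==v y) (f b * g c)))

  push-⊛≈pairSum : ∀ f g → push (f ⊛ g) ≋ pairSum f g
  push-⊛≈pairSum f g y = begin
    boxSum Y (λ b → when (φ b ==v y) (boxSum b (λ b' → f b' * g (b ∸v b'))))
      ≈⟨ sumMap-cong (box Y) restrict ⟩
    boxSum Y (λ b → boxSum Y (λ b' → when (φ b ==v y) (when (b' ≤v b) (f b' * g (b ∸v b')))))
      ≈⟨ sumMap-swap _ (box Y) (box Y) ⟩
    boxSum Y (λ b' → boxSum Y (λ b → when (φ b ==v y) (when (b' ≤v b) (f b' * g (b ∸v b')))))
      ≈⟨ sumMap-cong (box Y) (λ b' → sumMap-cong (box Y) (recentre b')) ⟩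
    boxSum Y (λ b' → boxSum Y (λ b → when (b' ≤v b) (T b' (b ∸v b'))))
      ≈⟨ sumMap-cong (box Y) (λ b' → boxSum-shift Y b' (T b')) ⟩
    boxSum Y (λ b' → boxSum Y (λ c → when ((b' +v c) ≤v Y) (T b' c)))
      ≈⟨ sumMap-cong (box Y) (λ b' → sumMap-cong (box Y) (λ c → split b' c)) ⟩
    pairSum f g y ∎
    where
    Y : Vec ℕ n
    Y = bound y
    T : Vec ℕ n → Vec ℕ n → Carrier
    T b' c = when (φ (b' +v c) ==v y) (f b' * g c)
    restrict : ∀ b → when (φ b ==v y) (boxSum b (λ b' → f b' * g (b ∸v b')))
                   ≈ boxSum Y (λ b' → when (φ b ==v y) (when (b' ≤v b) (f b' * g (b ∸v b'))))
    restrict b with φ b ==v y in φb≡y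
    ... | true  = ≈-sym (boxSum-restrict b Y (φ≡⇒≤bound b y φb≡y) _)
    ... | false = ≈-sym (sumMap-zero _ (box Y) (λ _ → ≈-refl))
    recentre : ∀ b' b → when (φ b ==v y) (when (b' ≤v b) (f b' * g (b ∸v b')))
                      ≈ when (b' ≤v b) (T b' (b ∸v b'))
    recentre b' b with b' ≤v b in b'≤b
    ... | false = when-0 (φ b ==v y)
    ... | true  rewrite +v-∸v b' b b'≤b = ≈-refl
    split : ∀ b' c → when ((b' +v c) ≤v Y) (T b' c) ≈ when ((φ b' +v φ c) ==v y) (f b' * g c)
    split b' c = ≈-trans (when-≤bound (b' +v c) y _) (when-≡ _ (cong (_==v y) (φ-+v b' c)))

  push⊛push≈pairSum : ∀ f g → (push f ⊛ push g) ≋ pairSum f g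
  push⊛push≈pairSum f g y = begin
    boxSum y (λ y' → push f y' * push g (y ∸v y'))
      ≈⟨ boxSum-cong y (λ y' y'≤y → *-cong (push-enlarge f y' Y (bound-mono y' y y'≤y))
                                            (push-enlarge g (y ∸v y') Y (bound-mono (y ∸v y') y (∸v-≤v y y')))) ⟩
    boxSum y (λ y' → boxSum Y (λ b → when (φ b ==v y') (f b)) * boxSum Y (λ c → when (φ c ==v (y ∸v y')) (g c)))
      ≈⟨ sumMap-cong (box y) (λ y' → ≈-trans (≈-sym (sumMap-*ʳ _ _ (box Y)))
                                             (sumMap-cong (box Y) (λ b → ≈-sym (sumMap-*ˡ _ _ (box Y))))) ⟩
    boxSum y (λ y' → boxSum Y (λ b → boxSum Y (λ c → P y' b c)))
      ≈⟨ sumMap-swap _ (box y) (box Y) ⟩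
    boxSum Y (λ b → boxSum y (λ y' → boxSum Y (λ c → P y' b c)))
      ≈⟨ sumMap-cong (box Y) (λ b → sumMap-swap _ (box y) (box Y)) ⟩
    boxSum Y (λ b → boxSum Y (λ c → boxSum y (λ y' → P y' b c)))
      ≈⟨ sumMap-cong (box Y) (λ b → sumMap-cong (box Y) (λ c → sumMap-cong (box y) (λ y' → factor y' b c))) ⟩
    boxSum Y (λ b → boxSum Y (λ c → boxSum y (λ y' → when (y' ==v φ b) (when (φ c ==v (y ∸v y')) (f b * g c)))))
      ≈⟨ sumMap-cong (box Y) (λ b → sumMap-cong (box Y) (λ c → boxSum-delta y (φ b) _)) ⟩
    boxSum Y (λ b → boxSum Y (λ c → when (φ b ≤v y) (when (φ c ==v (y ∸v φ b)) (f b * g c))))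
      ≈⟨ sumMap-cong (box Y) (λ b → sumMap-cong (box Y) (λ c → reflexive (merge b c))) ⟩
    pairSum f g y ∎
    where
    Y : Vec ℕ n
    Y = bound y
    P : Vec ℕ m → Vec ℕ n → Vec ℕ n → Carrier
    P y' b c = when (φ b ==v y') (f b) * when (φ c ==v (y ∸v y')) (g c)
    factor : ∀ y' b c → P y' b c ≈ when (y' ==v φ b) (when (φ c ==v (y ∸v y')) (f b * g c))
    factor y' b c rewrite ==v-sym (φ b) y' =
      ≈-trans (when-*ˡ (y' ==v φ b) _ _) (when-cong (y' ==v φ b) (when-*ʳ (φ c ==v (y ∸v y')) _ _))
    merge : ∀ b c → when (φ b ≤v y) (when (φ c ==v (y ∸v φ b)) (f b * g c))
                  ≡ when ((φ b +v φ c) ==v y) (f b * g c)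
    merge b c = trans (sym (when-∧ (φ b ≤v y) _ _))
                      (cong (λ t → when t (f b * g c)) (≤v∧==v∸v⇔+v==v (φ b) (φ c) y))

  push-⊛ : ∀ f g → push (f ⊛ g) ≋ (push f ⊛ push g)
  push-⊛ f g = ≋-trans (push-⊛≈pairSum f g) (≋-sym (push⊛push≈pairSum f g))

  push-pow : ∀ f k → push (pow f k) ≋ pow (push f) k
  push-pow f zero    = push-const 1#
  push-pow f (suc k) = ≋-trans (push-⊛ f (pow f k)) (⊛-cong ≋-refl (push-pow f k))

  -- geom (push f) is truncated at total y and geom f at total b; these agree on the fibre.
  push-geom : ∀ f → push (geom f) ≋ geom (push f)
  push-geom f y = ≈-sym (begin
    sumUpTo (total y) (λ k → pow (push f) k y)
      ≈⟨ sumUpTo-cong (total y) (λ k → ≈-sym (push-pow f k y)) ⟩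
    sumUpTo (total y) (λ k → boxSum Y (λ b → when (φ b ==v y) (pow f k b)))
      ≈⟨ sumMap-swap _ (List.upTo (suc (total y))) (box Y) ⟩
    boxSum Y (λ b → sumUpTo (total y) (λ k → when (φ b ==v y) (pow f k b)))
      ≈⟨ sumMap-cong (box Y) (λ b → sumMap-when (φ b ==v y) (λ k → pow f k b) (List.upTo (suc (total y)))) ⟩
    boxSum Y (λ b → when (φ b ==v y) (sumUpTo (total y) (λ k → pow f k b)))
      ≈⟨ sumMap-cong (box Y) on-fibre ⟩
    push (geom f) y ∎)
    where
    Y : Vec ℕ n
    Y = bound y
    on-fibre : ∀ b → when (φ b ==v y) (sumUpTo (total y) (λ k → pow f k b)) ≈ when (φ b ==v y) (geom f b)
    on-fibre b with φ b ==v y in φb≡y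
    ... | false = ≈-refl
    ... | true rewrite sym (==v⇒≡ (φ b) y φb≡y) | total-φ b = ≈-refl

module Collapse {n : ℕ} (S : Subset n) where

  onS offS : Vec ℕ n → Fin n → ℕ
  onS  b i = if lookup S i then lookup b i else 0
  offS b i = if lookup S i then 0 else lookup b i

  -- B_S(q^a) = w^d t^e with e the restriction of |a| to S and d = Σ_{i∉S} |a_i|; w comes first.
  collapse : Vec ℕ n → Vec ℕ (suc n)
  collapse b = total (tabulate (offS b)) ∷ tabulate (onS b)

  fibreBound : Vec ℕ (suc n) → Vec ℕ n
  fibreBound (d ∷ e) = tabulate (λ i → if lookup S i then lookup e i else d)

  onS-∈ : ∀ b {i} → lookup S i ≡ true → onS b i ≡ lookup b i
  onS-∈ b si rewrite si = refl

  offS-∉ : ∀ b {i} → lookup S i ≡ false → offS b i ≡ lookup b i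
  offS-∉ b si rewrite si = refl

  onS-+v : ∀ b c i → onS (b +v c) i ≡ onS b i ℕ.+ onS c i
  onS-+v b c i with lookup S i
  ... | true  = lookup-zipWith ℕ._+_ i b c
  ... | false = refl

  offS-+v : ∀ b c i → offS (b +v c) i ≡ offS b i ℕ.+ offS c i
  offS-+v b c i with lookup S i
  ... | true  = refl
  ... | false = lookup-zipWith ℕ._+_ i b c

  collapse-+v : ∀ b c → collapse (b +v c) ≡ collapse b +v collapse c
  collapse-+v b c = cong₂ _∷_
    (trans (cong total (tabulate-cong (offS-+v b c))) (total-tabulate-+ (offS b) (offS c)))
    (trans (tabulate-cong (onS-+v b c)) (tabulate-+v (onS b) (onS c)))

  collapse-zero : collapse zeroV ≡ zeroV
  collapse-zero = cong₂ _∷_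
    (trans (cong total (tabulate-cong offS-zero)) (total-tabulate-0 n))
    (lookup-ext _ _ λ i → trans (lookup∘tabulate (onS zeroV) i) (trans (onS-zero i) (sym (lookup-replicate i 0))))
    where
    onS-zero : ∀ i → onS zeroV i ≡ 0
    onS-zero i with lookup S i
    ... | true  = lookup-replicate i 0
    ... | false = refl
    offS-zero : ∀ i → offS zeroV i ≡ 0
    offS-zero i with lookup S i
    ... | true  = refl
    ... | false = lookup-replicate i 0

  total-collapse : ∀ b → total (collapse b) ≡ total b
  total-collapse b = begin
    total (tabulate (offS b)) ℕ.+ total (tabulate (onS b)) ≡⟨ total-tabulate-+ (offS b) (onS b) ⟨
    total (tabulate (λ i → offS b i ℕ.+ onS b i))          ≡⟨ cong total (tabulate-cong split) ⟩
    total (tabulate (lookup b))                            ≡⟨ cong total (tabulate∘lookup b) ⟩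
    total b                                                ∎
    where
    open ≡-Reasoning
    split : ∀ i → offS b i ℕ.+ onS b i ≡ lookup b i
    split i with lookup S i
    ... | true  = refl
    ... | false = ℕ.+-identityʳ (lookup b i)

  ≤fibreBound-collapse : ∀ b → (b ≤v fibreBound (collapse b)) ≡ true
  ≤fibreBound-collapse b = ≤⇒≤v b _ λ i → ℕ.≤-trans (coord i) (ℕ.≤-reflexive (sym (lookup∘tabulate _ i)))
    where
    coord : ∀ i → lookup b i ≤ (if lookup S i then lookup (tabulate (onS b)) i else total (tabulate (offS b)))
    coord i with lookup S i in si
    ... | true  = ℕ.≤-reflexive (sym (trans (lookup∘tabulate (onS b) i) (onS-∈ b si)))
    ... | false = ℕ.≤-trans (ℕ.≤-reflexive (sym (trans (lookup∘tabulate (offS b) i) (offS-∉ b si))))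
                            (lookup≤total (tabulate (offS b)) i)

  collapse≡⇒≤fibreBound : ∀ b y → (collapse b ==v y) ≡ true → (b ≤v fibreBound y) ≡ true
  collapse≡⇒≤fibreBound b y e =
    subst (λ y → (b ≤v fibreBound y) ≡ true) (==v⇒≡ (collapse b) y e) (≤fibreBound-collapse b)

  fibreBound-mono : ∀ y' y → (y' ≤v y) ≡ true → (fibreBound y' ≤v fibreBound y) ≡ true
  fibreBound-mono (d' ∷ e') (d ∷ e) le = ≤⇒≤v (fibreBound (d' ∷ e')) (fibreBound (d ∷ e)) λ i →
    ℕ.≤-trans (ℕ.≤-reflexive (lookup∘tabulate _ i))
              (ℕ.≤-trans (coord i) (ℕ.≤-reflexive (sym (lookup∘tabulate _ i))))
    where
    coord : ∀ i → (if lookup S i then lookup e' i else d') ≤ (if lookup S i then lookup e i else d)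
    coord i with lookup S i
    ... | true  = ≤v⇒≤ (d' ∷ e') (d ∷ e) le (Fin.suc i)
    ... | false = ≤v⇒≤ (d' ∷ e') (d ∷ e) le Fin.zero

  collapse-unitV-∈ : ∀ i → lookup S i ≡ true → collapse (unitV i) ≡ unitV (Fin.suc i)
  collapse-unitV-∈ i si = cong₂ _∷_
    (trans (cong total (tabulate-cong off-zero)) (total-tabulate-0 n))
    (trans (tabulate-cong on-id) (tabulate∘lookup (unitV i)))
    where
    off-zero : ∀ k → offS (unitV i) k ≡ 0
    off-zero k with lookup S k in sk
    ... | true  = refl
    ... | false = lookup-unitV-≢ (λ k≡i → separatedBy S si sk (sym k≡i))
    on-id : ∀ k → onS (unitV i) k ≡ lookup (unitV i) k
    on-id k with lookup S k in sk
    ... | true  = refl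
    ... | false = sym (lookup-unitV-≢ (λ k≡i → separatedBy S si sk (sym k≡i)))

  collapse-unitV-∉ : ∀ j → lookup S j ≡ false → collapse (unitV j) ≡ unitV Fin.zero
  collapse-unitV-∉ j sj = cong₂ _∷_
    (trans (cong total (trans (tabulate-cong off-id) (tabulate∘lookup (unitV j)))) (total-unitV j))
    (tabulate-cong on-zero)
    where
    off-id : ∀ k → offS (unitV j) k ≡ lookup (unitV j) k
    off-id k with lookup S k in sk
    ... | true  = sym (lookup-unitV-≢ (separatedBy S sk sj))
    ... | false = refl
    on-zero : ∀ k → onS (unitV j) k ≡ 0
    on-zero k with lookup S k in sk
    ... | true  = lookup-unitV-≢ (separatedBy S sk sj)
    ... | false = refl

module FriendlyMonomials {c ℓ} (R : CommutativeRing c ℓ) (β α : CommutativeRing.Carrier R)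
  {n : ℕ} (S : Subset n) where
  open CommutativeRing R renaming (refl to ≈-refl; sym to ≈-sym; trans to ≈-trans)
  open Series R
  open FiniteSums R
  open SeriesProperties R
  open Maps R β α n
  open Collapse S
  open Pushforward R collapse fibreBound collapse-+v collapse-zero total-collapse collapse≡⇒≤fibreBound fibreBound-mono

  supported : Vec ℕ n → Fin n → Bool
  supported e i = if lookup S i then true else (lookup e i ≡ᵇ 0)

  agreesOnS : Vec ℕ n → Vec ℕ n → Fin n → Bool
  agreesOnS e b i = if lookup S i then (lookup b i ≡ᵇ lookup e i) else true

  -- The test ok of the definition of B.
  agreesWith : Vec ℕ (suc n) → Vec ℕ n → Bool
  agreesWith (d ∷ e) b = allᵇ (agreesOnS e b) ∧ (total (tabulate (offS b)) ≡ᵇ d)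

  onS-≡ᵇ : ∀ b e i → (onS b i ≡ᵇ lookup e i) ≡ (supported e i ∧ agreesOnS e b i)
  onS-≡ᵇ b e i with lookup S i
  ... | true  = refl
  ... | false = trans (≡ᵇ-sym 0 (lookup e i)) (sym (∧-identityʳ _))

  collapse-==v : ∀ b d e → (collapse b ==v (d ∷ e)) ≡ (allᵇ (supported e) ∧ agreesWith (d ∷ e) b)
  collapse-==v b d e = begin
    (total (tabulate (offS b)) ≡ᵇ d) ∧ (tabulate (onS b) ==v e)
      ≡⟨ ∧-comm _ (tabulate (onS b) ==v e) ⟩
    (tabulate (onS b) ==v e) ∧ (total (tabulate (offS b)) ≡ᵇ d)
      ≡⟨ cong (_∧ _) (trans (tabulate-==v (onS b) e) (allᵇ-cong (onS-≡ᵇ b e))) ⟩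
    allᵇ (λ i → supported e i ∧ agreesOnS e b i) ∧ (total (tabulate (offS b)) ≡ᵇ d)
      ≡⟨ cong (_∧ _) (allᵇ-∧ (supported e) (agreesOnS e b)) ⟩
    (allᵇ (supported e) ∧ allᵇ (agreesOnS e b)) ∧ (total (tabulate (offS b)) ≡ᵇ d)
      ≡⟨ ∧-assoc (allᵇ (supported e)) _ _ ⟩
    allᵇ (supported e) ∧ agreesWith (d ∷ e) b ∎
    where open ≡-Reasoning

  B≋push : ∀ f → B S f ≋ push f
  B≋push f (d ∷ e) = begin
    when (allᵇ (supported e)) (boxSum Y (λ b → when (agreesWith (d ∷ e) b) (f b)))
      ≈⟨ boxSum-when-∧ Y (allᵇ (supported e)) (agreesWith (d ∷ e)) f ⟨
    boxSum Y (λ b → when (allᵇ (supported e) ∧ agreesWith (d ∷ e) b) (f b))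
      ≈⟨ sumMap-cong (box Y) (λ b → when-≡ (f b) (sym (collapse-==v b d e))) ⟩
    push f (d ∷ e) ∎
    where
    open import Relation.Binary.Reasoning.Setoid setoid
    Y : Vec ℕ n
    Y = fibreBound (d ∷ e)

  absV-eZ : ∀ i → absV (eZ i) ≡ unitV i
  absV-eZ i = lookup-ext _ _ λ k →
    trans (lookup-map k ℤ.∣_∣ (eZ i))
   (trans (cong ℤ.∣_∣ (lookup∘tabulate _ k))
   (trans (if-float ℤ.∣_∣ (toℕ k ≡ᵇ toℕ i)) (sym (lookup-unitV i k))))

  absV-neg-eZ : ∀ j → absV (Vec.map ℤ.-_ (eZ j)) ≡ unitV j
  absV-neg-eZ j = lookup-ext _ _ λ k →
    trans (lookup-map k ℤ.∣_∣ (Vec.map ℤ.-_ (eZ j)))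
   (trans (cong ℤ.∣_∣ (trans (lookup-map k ℤ.-_ (eZ j)) (cong ℤ.-_ (lookup∘tabulate _ k))))
   (trans (if-float (ℤ.∣_∣ ∘ ℤ.-_) (toℕ k ≡ᵇ toℕ j)) (sym (lookup-unitV j k))))

  absV-eZ-eZ : ∀ {i j} → i ≢ j → absV (zipWith ℤ._-_ (eZ i) (eZ j)) ≡ unitV i +v unitV j
  absV-eZ-eZ {i} {j} i≢j = lookup-ext _ _ λ k →
    trans (lookup-map k ℤ.∣_∣ (zipWith ℤ._-_ (eZ i) (eZ j)))
   (trans (cong ℤ.∣_∣ (trans (lookup-zipWith ℤ._-_ k (eZ i) (eZ j))
                             (cong₂ ℤ._-_ (lookup∘tabulate _ k) (lookup∘tabulate _ k))))
   (trans (coord k)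
          (sym (trans (lookup-zipWith ℕ._+_ k (unitV i) (unitV j))
                      (cong₂ ℕ._+_ (lookup-unitV i k) (lookup-unitV j k))))))
    where
    coord : ∀ k → ℤ.∣ (if toℕ k ≡ᵇ toℕ i then ℤ.+ 1 else ℤ.+ 0)
                    ℤ.- (if toℕ k ≡ᵇ toℕ j then ℤ.+ 1 else ℤ.+ 0) ∣
                ≡ (if toℕ k ≡ᵇ toℕ i then 1 else 0) ℕ.+ (if toℕ k ≡ᵇ toℕ j then 1 else 0)
    coord k with toℕ k ≡ᵇ toℕ i in k≡i | toℕ k ≡ᵇ toℕ j in k≡j
    ... | true  | true  = ⊥-elim (i≢j (trans (sym (toℕ-≡ᵇ⇒≡ k i k≡i)) (toℕ-≡ᵇ⇒≡ k j k≡j)))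
    ... | true  | false = refl
    ... | false | true  = refl
    ... | false | false = refl

  push-Ax : ∀ i j → lookup S i ≡ true → lookup S j ≡ false → push (Ax S i j) ≋ Et i
  push-Ax i j si sj = begin
    push (neg (X ⊛ geom Q))        ≈⟨ push-neg _ ⟩
    neg (push (X ⊛ geom Q))        ≈⟨ neg-cong (push-⊛ X (geom Q)) ⟩
    neg (push X ⊛ push (geom Q))   ≈⟨ neg-cong (⊛-cong push-X (≋-trans (push-geom Q) (geom-cong push-Q))) ⟩
    Et i                           ∎
    where
    open import Relation.Binary.Reasoning.Setoid (≋-setoid (suc n))
    qᵢ qⱼ⁻¹ Q : Ser n
    qᵢ   = qmon S (eZ i)
    qⱼ⁻¹ = qmon S (Vec.map ℤ.-_ (eZ j))
    Q    = qmon S (zipWith ℤ._-_ (eZ i) (eZ j))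
    X : Ser n
    X = (qᵢ ⊕ const β) ⊕ scale α qⱼ⁻¹
    push-qᵢ : push qᵢ ≋ tvar i
    push-qᵢ = ≋-trans (push-monomial 1# _)
                      (monomial-≡ 1# (trans (cong collapse (absV-eZ i)) (collapse-unitV-∈ i si)))
    push-qⱼ⁻¹ : push qⱼ⁻¹ ≋ wvar
    push-qⱼ⁻¹ = ≋-trans (push-monomial 1# _)
                        (monomial-≡ 1# (trans (cong collapse (absV-neg-eZ j)) (collapse-unitV-∉ j sj)))
    push-X : push X ≋ ((tvar i ⊕ const β) ⊕ scale α wvar)
    push-X = ≋-trans (push-⊕ _ _)
      (⊕-cong (≋-trans (push-⊕ _ _) (⊕-cong push-qᵢ (push-const β)))
              (≋-trans (push-scale α qⱼ⁻¹) (scale-cong α push-qⱼ⁻¹)))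
    push-Q : push Q ≋ (tvar i ⊛ wvar)
    push-Q = begin
      push Q
        ≈⟨ push-monomial 1# _ ⟩
      monomial 1# (collapse (absV (zipWith ℤ._-_ (eZ i) (eZ j))))
        ≈⟨ monomial-≡ 1# (trans (cong collapse (absV-eZ-eZ (separatedBy S si sj)))
                                (trans (collapse-+v (unitV i) (unitV j))
                                       (cong₂ _+v_ (collapse-unitV-∈ i si) (collapse-unitV-∉ j sj)))) ⟩
      monomial 1# (unitV (Fin.suc i) +v unitV Fin.zero)
        ≈⟨ monomial-cong _ (*-identityˡ 1#) ⟨
      monomial (1# * 1#) (unitV (Fin.suc i) +v unitV Fin.zero)
        ≈⟨ monomial-⊛ 1# 1# (unitV (Fin.suc i)) (unitV Fin.zero) ⟨
      tvar i ⊛ wvar ∎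

  push-A≋E∘D : ∀ m (fr : Friendly S m) → push (A S m fr) ≋ E (D m)
  push-A≋E∘D []            []                 = push-const 1#
  push-A≋E∘D ((i , j) ∷ m) ((i∈S , j∉S) ∷ fr) =
    ≋-trans (push-⊛ _ _)
            (⊛-cong (push-Ax i j ([]=⇒lookup i∈S) (∉⇒lookup≡false S j∉S)) (push-A≋E∘D m fr))

  E∘D≋B∘A : ∀ m (fr : Friendly S m) → E (D m) ≋ B S (A S m fr)
  E∘D≋B∘A m fr = ≋-sym (≋-trans (B≋push (A S m fr)) (push-A≋E∘D m fr))

module FirstIndices {n : ℕ} where

  isFirstIndex : Mon n → Fin n → Bool
  isFirstIndex m k = does (any? (λ p → proj₁ p Fin.≟ k) m)

  firstIndices : Mon n → Subset n
  firstIndices m = tabulate (isFirstIndex m)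

  ∈firstIndices⁺ : ∀ {m i j} → (i , j) LMem.∈ m → i ∈ firstIndices m
  ∈firstIndices⁺ {m} {i} ij∈m =
    lookup⇒[]= i (firstIndices m)
      (trans (lookup∘tabulate (isFirstIndex m) i) (dec-true (any? _ m) (LMem.lose ij∈m refl)))

  ∈firstIndices⁻ : ∀ {m k} → k ∈ firstIndices m → ∃[ j ] (k , j) LMem.∈ m
  ∈firstIndices⁻ {m} {k} k∈
    with any? (λ p → proj₁ p Fin.≟ k) m | trans (sym (lookup∘tabulate (isFirstIndex m) k)) ([]=⇒lookup k∈)
  ... | yes k-first | _ with LMem.find k-first
  ...   | (.k , j) , kj∈m , refl = j , kj∈m
  ∈firstIndices⁻ _ | no _ | ()

  firstIndices-inRange : ∀ {m} → WellFormed m → InRange (firstIndices m)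
  firstIndices-inRange wf i i∈ with ∈firstIndices⁻ i∈
  ... | j , ij∈m = ℕ.<-≤-trans (s≤s (All.lookup wf ij∈m)) (Fin.toℕ<n j)

  -- No second index is a first index: that would be a path x_{i,j} x_{j,k}.
  firstIndices-friendly : ∀ {m} → WellFormed m → Pathless m → Friendly (firstIndices m) m
  firstIndices-friendly wf pathless = All.tabulate λ {(i , j)} ij∈m →
    ∈firstIndices⁺ ij∈m , λ j∈ → let k , jk∈m = ∈firstIndices⁻ j∈ in
      pathless i j k (All.lookup wf ij∈m) (All.lookup wf jk∈m) (ij∈m , jk∈m)

open FirstIndices

proposition3p16 : ∀ {c ℓ} (R : CommutativeRing c ℓ) (β α : CommutativeRing.Carrier R)
    (n : ℕ) → 1 ≤ n → (m : Mon n) → WellFormed m → Pathless m →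
    (Σ (Subset n) (λ S → InRange S × Friendly S m))
    × (∀ (S : Subset n) → InRange S → (fr : Friendly S m) →
         Series._≋_ R (Maps.E R β α n (Maps.D R β α n m)) (Maps.B R β α n S (Maps.A R β α n S m fr)))
proposition3p16 R β α n _ m wf pathless =
  (firstIndices m , firstIndices-inRange wf , firstIndices-friendly wf pathless) ,
  λ S _ → FriendlyMonomials.E∘D≋B∘A R β α S m
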